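{- Let $\Sigma$ be a non-empty finite alphabet and $D$ an infinite set of data values. The class of data languages recognized by register automata and the class of data languages recognized by session automata are incomparable (neither is contained in the other). Moreover, the class of data languages recognized by fresh-register automata strictly contains both the class recognized by register automata and the class recognized by session automata.
   Context: A data word over $\Sigma$ and $D$ is an element of $(\Sigma\times D)^*$. For a finite set $\mathcal R$ of registers, a register operation is one of $r^{\circledast}$ (write a globally fresh value into $r$), $r^{\odot}$ (write a locally fresh value into $r$), $r^{\uparrow}$ (read the value in $r$), for $r\in\mathcal R$. A fresh-register automaton is a tuple $(S,\mathcal R,\iota,F,\Delta)$ with $S$ a non-empty finite set of states, $\mathcal R$ a non-empty finite set of registers, $\iota\in S$ initial, $F\subseteq S$ final, and $\Delta$ a finite set of transitions $(s,(a,\pi),s')$ with $s,s'\in S$, $a\in\Sigma$, $\pi$ a register operation. A configuration is $(s,\tau,U)$ with $s\in S$, $\tau:\mathcal R\rightharpoonup D$ a partial map, $U\subseteq D$ the set of data values used so far. For $(a,d)\in\Sigma\times D$, $(s,\tau,U)\to(s',\tau',U')$ if there is a transition $(s,(a,\pi),s')$ with register $r$ of $\pi$ such that: $d=\tau(r)$ if $\pi=r^\uparrow$; $d\notin\tau(\mathcal R)$ (the set of values currently stored) if $\pi=r^\odot$; $d\notin U$ if $\pi=r^\circledast$; and $\tau'$ equals $\tau$ except $\tau'(r)=d$ (with domain $\mathrm{dom}(\tau)\cup\{r\}$), $U'=U\cup\{d\}$. A run on $(a_1,d_1)\cdots(a_n,d_n)$ starts in $(\iota,\emptyset,\emptyset)$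 and takes these steps; it is accepting if it ends in a state of $F$. The language $L(\mathcal A)$ is the set of data words with an accepting run. A register automaton is a fresh-register automaton using only operations $r^\odot,r^\uparrow$; a session automaton is one using only operations $r^\circledast,r^\uparrow$. -}

module Defs where

open import Data.Nat using (ℕ; suc)
open import Data.Fin using (Fin)
open import Data.Bool using (Bool; true)
open import Data.Maybe using (Maybe; just; nothing)
open import Data.List using (List; []; _∷_)
open import Data.List.Membership.Propositional using (_∈_; _∉_)
open import Data.Product using (_×_; _,_; Σ-syntax; ∃-syntax)
open import Relation.Binary.PropositionalEquality using (_≡_; _≢_)
open import Relation.Nullary using (¬_)
open import Function.Bundles using (_⇔_)

DataWord : Set → Set → Set
DataWord Σ D = List (Σ × D)

data Op (R : Set) : Set where
  gfresh : R → Op R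
  lfresh : R → Op R
  read   : R → Op R

opReg : ∀ {R} → Op R → R
opReg (gfresh r) = r
opReg (lfresh r) = r
opReg (read r)   = r

-- Fresh-register automaton: states Fin nS (non-empty since ι exists),
-- registers Fin (suc nR) (non-empty), finite transition list Δ.
record FRA (Σ : Set) : Set where
  field
    nS  : ℕ
    nR  : ℕ
    ι   : Fin nS
    F   : Fin nS → Bool
    Δ   : List (Fin nS × (Σ × Op (Fin (suc nR))) × Fin nS)

module _ {Σ D : Set} (A : FRA Σ) where
  open FRA A

  Reg : Set
  Reg = Fin (suc nR)

  -- configuration (s, τ, U); τ a partial map, U the finite set of used values
  record Config : Set where
    constructor ⟨_,_,_⟩
    field
      state : Fin nS
      τ     : Reg → Maybe D
      U     : List D

  Stored : (Reg → Maybe D) → D → Set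
  Stored τ d = ∃[ r ] (τ r ≡ just d)

  OpCond : Op Reg → (Reg → Maybe D) → List D → D → Set
  OpCond (gfresh r) τ U d = d ∉ U
  OpCond (lfresh r) τ U d = ¬ Stored τ d
  OpCond (read r)   τ U d = τ r ≡ just d

  update : (Reg → Maybe D) → Reg → D → Reg → Maybe D
  update τ r d r' with r' Data.Fin.≟ r
  ... | Relation.Nullary.yes _ = just d
  ... | Relation.Nullary.no _  = τ r'

  data Step : Config → Σ × D → Config → Set where
    step : ∀ {s s' a π τ U d} →
           (s , (a , π) , s') ∈ Δ →
           OpCond π τ U d →
           Step ⟨ s , τ , U ⟩ (a , d) ⟨ s' , update τ (opReg π) d , d ∷ U ⟩

  data Run : Config → DataWord Σ D → Config → Set where
    done : ∀ {c} → Run c [] c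
    next : ∀ {c c' c'' x w} → Step c x c' → Run c' w c'' → Run c (x ∷ w) c''

  initial : Config
  initial = ⟨ ι , (λ _ → nothing) , [] ⟩

  Accepts : DataWord Σ D → Set
  Accepts w = ∃[ c ] (Run initial w c × F (Config.state c) ≡ true)

IsRegOp IsSessOp : ∀ {R} → Op R → Set
IsRegOp (gfresh _) = Data.Empty.⊥ where import Data.Empty
IsRegOp (lfresh _) = Data.Unit.⊤ where import Data.Unit
IsRegOp (read _)   = Data.Unit.⊤ where import Data.Unit
IsSessOp (gfresh _) = Data.Unit.⊤ where import Data.Unit
IsSessOp (lfresh _) = Data.Empty.⊥ where import Data.Empty
IsSessOp (read _)   = Data.Unit.⊤ where import Data.Unit

open import Data.List.Relation.Unary.All using (All)

IsRA IsSA : ∀ {Σ} → FRA Σ → Set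
IsRA A = All (λ t → IsRegOp (Data.Product.proj₂ (Data.Product.proj₁ (Data.Product.proj₂ t)))) (FRA.Δ A)
IsSA A = All (λ t → IsSessOp (Data.Product.proj₂ (Data.Product.proj₁ (Data.Product.proj₂ t)))) (FRA.Δ A)

Kind : Set → Set₁
Kind Σ = FRA Σ → Set

AnyFRA : ∀ {Σ} → Kind Σ
AnyFRA _ = Data.Unit.⊤ where import Data.Unit

SameLang : (Σ D : Set) → FRA Σ → FRA Σ → Set
SameLang Σ D A B = (w : DataWord Σ D) → Accepts {Σ} {D} A w ⇔ Accepts {Σ} {D} B w

_⊆⟨_⟩_ : ∀ {Σ} → Kind Σ → Set → Kind Σ → Set
_⊆⟨_⟩_ {Σ} K D K' = (A : FRA Σ) → K A → ∃[ B ] (K' B × SameLang Σ D A B)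

_⊂⟨_⟩_ : ∀ {Σ} → Kind Σ → Set → Kind Σ → Set
K ⊂⟨ D ⟩ K' = (K ⊆⟨ D ⟩ K') × ¬ (K' ⊆⟨ D ⟩ K)

-- Fix a letter a and pairwise distinct data values f 0, f 1, ….  Two one-state,
-- one-register automata serve as witnesses:
--   * A≢ (an RA, loop reading a locally fresh value) accepts the words whose
--     consecutive data differ.  A session automaton with k registers cannot:
--     on  d₀ … d_{k} d₀ … d_{k}  the second half only reads used values, so all
--     of them must sit in registers at the midpoint — too many for k registers.
--   * A# (an SA, loop reading a globally fresh value) accepts the words whose
--     data are pairwise distinct.  A register automaton with k registers cannot:
--     to accept  d₀ … d_{k} d_{k+1}  its last step must read a locally fresh
--     value; one of d₀ … d_{k} is then also unstored, so it would accept a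
--     repetition as well.

module Submission where

open import Defs
open import Data.Nat using (ℕ; suc; _<_)
import Data.Nat.Properties as ℕ
open import Data.Fin using (Fin; toℕ; _≟_) renaming (zero to fz; suc to fs)
open import Data.Fin.Properties using (pigeonhole; toℕ<n; toℕ-injective; <-irrefl)
open import Data.Bool using (true)
open import Data.Maybe using (Maybe; just)
open import Data.Maybe.Properties using (just-injective)
open import Data.Maybe.Relation.Binary.Connected using (Connected; just)
open import Data.List using (List; []; _∷_; _++_; _∷ʳ_; map; upTo; last)
open import Data.List.Properties using (map-++; map-∘; map-id; upTo-∷ʳ)
open import Data.List.Membership.Propositional using (_∈_; _∉_)
open import Data.List.Membership.Propositional.Properties
  using (∈-map⁺; ∈-map⁻; ∈-upTo⁺; ∈-upTo⁻)
open import Data.List.Relation.Binary.Subset.Propositional using (_⊆_)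
open import Data.List.Relation.Unary.Any using (here; there)
open import Data.List.Relation.Unary.All as All using (All; []; _∷_)
open import Data.List.Relation.Unary.AllPairs using ([]; _∷_)
open import Data.List.Relation.Unary.Linked as Linked using (Linked; [-]; _∷_)
open import Data.List.Relation.Unary.Linked.Properties as Linkedₚ using (AllPairs⇒Linked)
open import Data.List.Relation.Unary.Unique.Propositional using (Unique)
open import Data.List.Relation.Unary.Unique.Propositional.Properties as Uniqueₚ using (upTo⁺)
open import Data.Product using (∃-syntax; _×_; _,_; proj₁; proj₂)
open import Data.Sum using (_⊎_; inj₁; inj₂)
open import Data.Unit using (tt)
open import Data.Empty using (⊥; ⊥-elim)
open import Function using (_∘_; id)
open import Function.Bundles using (_↔_; _↣_; mk⇔; Inverse; Injection; Equivalence)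
open import Relation.Binary.PropositionalEquality using (_≡_; _≢_; refl; sym; trans; cong; subst)
open import Relation.Nullary using (¬_; yes; no)

dataOf : {Σ D : Set} → DataWord Σ D → List D
dataOf = map proj₂

module Runs {Σ D : Set} (A : FRA Σ) where
  open Config

  Conf : Set
  Conf = Config {Σ} {D} A

  Valuation : Set
  Valuation = Reg {Σ} {D} A → Maybe D

  split : ∀ {c c' : Conf} w₁ {w₂} → Run A c (w₁ ++ w₂) c' →
          ∃[ m ] (Run A c w₁ m × Run A m w₂ c')
  split []       r          = _ , done , r
  split (x ∷ w₁) (next s r) = let m , r₁ , r₂ = split w₁ r in m , next s r₁ , r₂

  append : ∀ {c m c' : Conf} {w₁ w₂} → Run A c w₁ m → Run A m w₂ c' → Run A c (w₁ ++ w₂) c'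
  append done        r₂ = r₂
  append (next s r₁) r₂ = next s (append r₁ r₂)

  used-grows : ∀ {c c' : Conf} {w} → Run A c w c' → U c ⊆ U c'
  used-grows done                = id
  used-grows (next (step _ _) r) = used-grows r ∘ there

  data⊆used : ∀ {c c' : Conf} {w} → Run A c w c' → dataOf w ⊆ U c'
  data⊆used (next (step _ _) r) (here refl) = used-grows r (here refl)
  data⊆used (next (step _ _) r) (there p)   = data⊆used r p

  used-origin : ∀ {c c' : Conf} {w y} → Run A c w c' → y ∈ U c' → y ∈ U c ⊎ y ∈ dataOf w
  used-origin done p = inj₁ p
  used-origin (next (step _ _) r) p with used-origin r p
  ... | inj₁ (here refl) = inj₂ (here refl)
  ... | inj₁ (there q)   = inj₁ q
  ... | inj₂ q           = inj₂ (there q)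

  stored-update : ∀ (τ : Valuation) r d {y} → Stored A (update A τ r d) y → y ≡ d ⊎ Stored A τ y
  stored-update τ r d (r' , eq) with r' ≟ r
  ... | yes _ = inj₁ (sym (just-injective eq))
  ... | no _  = inj₂ (r' , eq)

  read-keeps-stored : ∀ {τ : Valuation} {r d y} → τ r ≡ just d → Stored A (update A τ r d) y → Stored A τ y
  read-keeps-stored {τ} {r} {d} holds s with stored-update τ r d s
  ... | inj₁ refl = r , holds
  ... | inj₂ s'   = s'

  stored⊆used : ∀ {c c' : Conf} {w} → Run A c w c' →
                (∀ {y} → Stored A (τ c) y → y ∈ U c) → ∀ {y} → Stored A (τ c') y → y ∈ U c'
  stored⊆used done inv = inv
  stored⊆used (next (step {π = π} {τ = τ} {U = used} {d = d} _ _) r) inv =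
    stored⊆used r λ s → case-stored (stored-update τ (opReg π) d s)
    where
    case-stored : ∀ {y} → y ≡ d ⊎ Stored A τ y → y ∈ d ∷ used
    case-stored (inj₁ refl) = here refl
    case-stored (inj₂ s)    = there (inv s)

  stored-occurs : ∀ {c : Conf} {w y} → Run A (initial A) w c → Stored A (τ c) y → y ∈ dataOf w
  stored-occurs r s with used-origin r (stored⊆used r (λ ()) s)
  ... | inj₁ ()
  ... | inj₂ p = p

  -- A session automaton cannot produce already used values except by reading
  -- them: if all data of w were used before, they were all stored before.
  session-reads-stored : IsSA A → ∀ {c c' : Conf} {w} → Run A c w c' →
                         dataOf w ⊆ U c → ∀ {x} → x ∈ dataOf w → Stored A (τ c) x
  session-reads-stored sa (next (step {π = gfresh _} _ fresh) r) used p = ⊥-elim (fresh (used (here refl)))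
  session-reads-stored sa (next (step {π = lfresh _} δ _) r) used p     = ⊥-elim (All.lookup sa δ)
  session-reads-stored sa (next (step {π = read r₀} _ holds) r) used (here refl) = r₀ , holds
  session-reads-stored sa (next (step {π = read r₀} _ holds) r) used (there p) =
    read-keeps-stored holds (session-reads-stored sa r (λ q → there (used (there q))) p)

registers-hold-few : ∀ {D : Set} {k n} (τ : Fin k → Maybe D) (g : Fin n → D) → k < n →
                     (∀ {i j} → g i ≡ g j → i ≡ j) → ¬ (∀ j → ∃[ r ] (τ r ≡ just (g j)))
registers-hold-few τ g k<n g-inj holds
  with i , j , i<j , same ← pigeonhole k<n (proj₁ ∘ holds) =
  <-irrefl (g-inj (just-injective (trans (sym (proj₂ (holds i)))
                                         (trans (cong τ same) (proj₂ (holds j)))))) i<j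

-- Double negation commutes with finite conjunctions.  Storage of a value is not
-- decidable (D has no decidable equality), so the RA separation argues under ¬¬.
¬¬-∀-Fin : ∀ n {P : Fin n → Set} → (∀ j → ¬ ¬ P j) → ¬ ¬ (∀ j → P j)
¬¬-∀-Fin 0       h no-all = no-all λ ()
¬¬-∀-Fin (suc n) h no-all =
  h fz λ p₀ → ¬¬-∀-Fin n (h ∘ fs) λ rest → no-all λ { fz → p₀ ; (fs j) → rest j }

last-∷ʳ : ∀ {A : Set} (xs : List A) x → last (xs ∷ʳ x) ≡ just x
last-∷ʳ []           x = refl
last-∷ʳ (y ∷ [])     x = refl
last-∷ʳ (y ∷ z ∷ zs) x = last-∷ʳ (z ∷ zs) x

upTo-twice-linked : ∀ n → Linked _≢_ (upTo (suc (suc n)) ++ upTo (suc (suc n)))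
upTo-twice-linked n = Linkedₚ.++⁺ distinct seam distinct
  where
  distinct : Linked _≢_ (upTo (suc (suc n)))
  distinct = AllPairs⇒Linked (upTo⁺ (suc (suc n)))
  seam : Connected _≢_ (last (upTo (suc (suc n)))) (just 0)
  seam = subst (λ xs → Connected _≢_ (last xs) (just 0)) (upTo-∷ʳ (suc n))
           (subst (λ l → Connected _≢_ l (just 0)) (sym (last-∷ʳ (upTo (suc n)) (suc n)))
             (just λ ()))

module Values {D : Set} (f : ℕ → D) (f-inj : ∀ {x y} → f x ≡ f y → x ≡ y) where

  values : ℕ → List D
  values n = map f (upTo n)

  values-unique : ∀ n → Unique (values n)
  values-unique n = Uniqueₚ.map⁺ f-inj (upTo⁺ n)

  ∈-values : ∀ {n j} → j < n → f j ∈ values n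
  ∈-values = ∈-map⁺ f ∘ ∈-upTo⁺

  ∉-values : ∀ n → f n ∉ values n
  ∉-values n p with j , j∈ , fn≡fj ← ∈-map⁻ f p = ℕ.<-irrefl (sym (f-inj fn≡fj)) (∈-upTo⁻ j∈)

  values-suc : ∀ n → values (suc n) ≡ values n ++ f n ∷ []
  values-suc n = trans (cong (map f) (sym (upTo-∷ʳ n))) (map-++ f (upTo n) (n ∷ []))

  values-twice-linked : ∀ n → Linked _≢_ (values (suc (suc n)) ++ values (suc (suc n)))
  values-twice-linked n =
    subst (Linked _≢_) (map-++ f (upTo (suc (suc n))) (upTo (suc (suc n))))
      (Linkedₚ.map⁺ (Linked.map (λ x≢y → x≢y ∘ f-inj) (upTo-twice-linked n)))

module Witnesses {Σ D : Set} (a : Σ) where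

  word : List D → DataWord Σ D
  word = map (a ,_)

  dataOf-word : ∀ ds → dataOf (word ds) ≡ ds
  dataOf-word ds = trans (sym (map-∘ ds)) (map-id ds)

  A≢ : FRA Σ
  A≢ = record { nS = 1 ; nR = 0 ; ι = fz ; F = λ _ → true
              ; Δ = (fz , (a , lfresh fz) , fz) ∷ [] }

  A# : FRA Σ
  A# = record { nS = 1 ; nR = 0 ; ι = fz ; F = λ _ → true
              ; Δ = (fz , (a , gfresh fz) , fz) ∷ [] }

  A≢-isRA : IsRA A≢
  A≢-isRA = tt ∷ []

  A#-isSA : IsSA A#
  A#-isSA = tt ∷ []

  A≢-runs : ∀ {τ U d ds} → ¬ Stored A≢ τ d → Linked _≢_ (d ∷ ds) →
            ∃[ c ] Run A≢ ⟨ fz , τ , U ⟩ (word (d ∷ ds)) c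
  A≢-runs unstored [-]          = _ , next (step (here refl) unstored) done
  A≢-runs unstored (d≢e ∷ rest) =
    let c , r = A≢-runs only-d-stored rest in c , next (step (here refl) unstored) r
    where
    only-d-stored : ¬ Stored A≢ _ _
    only-d-stored (fz , eq) = d≢e (just-injective eq)

  A≢-accepts : ∀ {ds} → Linked _≢_ ds → Accepts {Σ} {D} A≢ (word ds)
  A≢-accepts {[]}    _ = _ , done , refl
  A≢-accepts {_ ∷ _} l = let c , r = A≢-runs (λ ()) l in c , r , refl

  A#-runs : ∀ {τ U ds} → All (_∉ U) ds → Unique ds → ∃[ c ] Run A# ⟨ fz , τ , U ⟩ (word ds) c
  A#-runs [] [] = _ , done
  A#-runs (d∉U ∷ rest∉U) (d≢rest ∷ rest-unique) =
    let c , r = A#-runs (All.zipWith unused (d≢rest , rest∉U)) rest-unique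
    in  c , next (step (here refl) d∉U) r
    where
    unused : ∀ {d U x} → d ≢ x × x ∉ U → x ∉ d ∷ U
    unused (d≢x , x∉U) (here x≡d) = d≢x (sym x≡d)
    unused (d≢x , x∉U) (there p)  = x∉U p

  A#-accepts : ∀ {ds} → Unique ds → Accepts {Σ} {D} A# (word ds)
  A#-accepts u = let c , r = A#-runs (All.universal (λ _ ()) _) u in c , r , refl

  A#-rejects-repeat : ∀ {ds x} → x ∈ ds → ¬ Accepts A# (word ds ++ (a , x) ∷ [])
  A#-rejects-repeat {ds} x∈ds (c , r , _) with Runs.split A# (word ds) r
  ... | _ , r₁ , next (step (here refl) fresh) done =
        fresh (Runs.data⊆used A# r₁ (subst (_ ∈_) (sym (dataOf-word ds)) x∈ds))

module Separation {Σ D : Set} (a : Σ) (f : ℕ → D) (f-inj : ∀ {x y} → f x ≡ f y → x ≡ y) where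
  open Values f f-inj
  open Witnesses {Σ} {D} a

  fin-values-inj : ∀ {n} {i j : Fin n} → f (toℕ i) ≡ f (toℕ j) → i ≡ j
  fin-values-inj = toℕ-injective ∘ f-inj

  ∈-word-values : ∀ {n} (j : Fin n) → f (toℕ j) ∈ dataOf (word (values n))
  ∈-word-values {n} j = subst (_ ∈_) (sym (dataOf-word (values n))) (∈-values (toℕ<n j))

  A≢-not-session : ∀ B → IsSA B → ¬ SameLang Σ D A≢ B
  A≢-not-session B sa same = refute (Equivalence.to (same (word ds ++ word ds)) accepted)
    where
    open Runs {Σ} {D} B
    ds : List D
    ds = values (suc (suc (FRA.nR B)))
    accepted : Accepts A≢ (word ds ++ word ds)
    accepted = subst (Accepts A≢) (map-++ (a ,_) ds ds)
                 (A≢-accepts (values-twice-linked (FRA.nR B)))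
    -- At the midpoint all values of the second half must be stored.
    refute : Accepts B (word ds ++ word ds) → ⊥
    refute (c , r , _) with mid , r₁ , r₂ ← split (word ds) r =
      registers-hold-few (Config.τ mid) (f ∘ toℕ) (ℕ.n<1+n _) fin-values-inj
        λ j → session-reads-stored sa r₂ (data⊆used r₁) (∈-word-values j)

  A#-not-register : ∀ B → IsRA B → ¬ SameLang Σ D A# B
  A#-not-register B ra same = refute (Equivalence.to (same (word ds ++ (a , f N) ∷ [])) accepted)
    where
    open Runs {Σ} {D} B
    N : ℕ
    N = suc (suc (FRA.nR B))
    ds : List D
    ds = values N
    accepted : Accepts A# (word ds ++ (a , f N) ∷ [])
    accepted = subst (Accepts A#) (trans (cong word (values-suc N)) (map-++ (a ,_) ds _))
                 (A#-accepts (values-unique (suc N)))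
    -- The last step reads f N, which is not among the earlier data: a read is
    -- impossible, and a locally fresh step would equally accept a repetition
    -- of one of the N earlier values, as the registers cannot hold all of them.
    last-step : ∀ {mid c : Conf} → Run B (initial B) (word ds) mid →
                Run B mid ((a , f N) ∷ []) c → FRA.F B (Config.state c) ≡ true → ⊥
    last-step r₁ (next (step {π = gfresh _} δ _) done) _ = All.lookup ra δ
    last-step r₁ (next (step {π = read r} δ holds) done) _ =
      ∉-values N (subst (f N ∈_) (dataOf-word ds) (stored-occurs r₁ (r , holds)))
    last-step r₁ (next (step {π = lfresh _} {τ = τ} δ _) done) final =
      ¬¬-∀-Fin N
        (λ j unstored → A#-rejects-repeat (∈-values (toℕ<n j))
          (Equivalence.from (same _) (_ , append r₁ (next (step δ unstored) done) , final)))
        (registers-hold-few τ (f ∘ toℕ) (ℕ.n<1+n _) fin-values-inj)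
    refute : Accepts B (word ds ++ (a , f N) ∷ []) → ⊥
    refute (c , r , final) with _ , r₁ , r₂ ← split (word ds) r = last-step r₁ r₂ final

escapes : ∀ {Σ D} {K K' : Kind Σ} (A : FRA Σ) → K A →
          (∀ B → K' B → ¬ SameLang Σ D A B) → ¬ (K ⊆⟨ D ⟩ K')
escapes A kA unmatched K⊆K' = let B , k'B , same = K⊆K' A kA in unmatched B k'B same

⊆-AnyFRA : ∀ {Σ D} (K : Kind Σ) → K ⊆⟨ D ⟩ AnyFRA
⊆-AnyFRA K A _ = A , tt , λ _ → mk⇔ id id

proposition2p5 : {Σ D : Set} → (k : ℕ) → Σ ↔ Fin (suc k) → ℕ ↣ D →
    (¬ (IsRA {Σ} ⊆⟨ D ⟩ IsSA) × ¬ (IsSA {Σ} ⊆⟨ D ⟩ IsRA))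
    × (IsRA {Σ} ⊂⟨ D ⟩ AnyFRA) × (IsSA {Σ} ⊂⟨ D ⟩ AnyFRA)
proposition2p5 {Σ} {D} k letters ℕ↣D =
    (escapes A≢ A≢-isRA A≢-not-session , escapes A# A#-isSA A#-not-register)
  , (⊆-AnyFRA IsRA , escapes A# tt A#-not-register)
  , (⊆-AnyFRA IsSA , escapes A≢ tt A≢-not-session)
  where
  a : Σ
  a = Inverse.from letters fz
  open Witnesses {Σ} {D} a using (A≢; A#; A≢-isRA; A#-isSA)
  open Separation a (Injection.to ℕ↣D) (Injection.injective ℕ↣D)
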